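{- Let $\lambda\neq0$. For integers $n\ge0$ and $m\in\mathbb{N}$, \[ \frac{2^n}{n+1}\bigl(b_{n+1,\lambda}(m)-b_{n+1,\lambda}\bigr)=\sum_{l=0}^{m-1}(2l+1)_{n,2\lambda}. \]
   Context: $(x)_{0,\lambda}=1$, $(x)_{k,\lambda}=x(x-\lambda)\cdots(x-(k-1)\lambda)$ for $k\ge1$; $e_\lambda^x(t)=(1+\lambda t)^{x/\lambda}=\sum_{k\ge0}(x)_{k,\lambda}\frac{t^k}{k!}$. Degenerate Carlitz type 2 Bernoulli polynomials: $\frac{t}{e_\lambda^{1/2}(t)-e_\lambda^{ -1/2}(t)}e_\lambda^x(t)=\sum_{n\ge0}b_{n,\lambda}(x)\frac{t^n}{n!}$ (formal power series in $t$), and $b_{n,\lambda}=b_{n,\lambda}(0)$.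
   Formalization: The parameter λ is a nonzero rational rather than a nonzero real number. -}

module Defs where

open import Data.Nat as ℕ using (ℕ; zero; suc; _!; _∸_)
open import Data.Nat.Properties using (_!≢0)
open import Data.Integer using (+_)
open import Data.Rational using (ℚ; 0ℚ; 1ℚ; _+_; _*_; _-_; -_; _/_)
open import Data.List using (List; []; _∷_; map; foldr; upTo)

FPS : Set
FPS = ℕ → ℚ

ι : ℕ → ℚ
ι n = + n / 1

Σ< : ℕ → (ℕ → ℚ) → ℚ
Σ< n f = foldr _+_ 0ℚ (map f (upTo n))

fall : ℚ → ℕ → ℚ → ℚ
fall x zero    lam = 1ℚ
fall x (suc k) lam = fall x k lam * (x - ι k * lam)

eλ : ℚ → ℚ → FPS
eλ lam x k = fall x k lam * ((+ 1 / (k !)) {{k !≢0}})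

_⊛_ : FPS → FPS → FPS
(f ⊛ g) n = Σ< (suc n) (λ j → f j * g (n ∸ j))

-- Multiplicative inverse of a formal power series E with E 0 = 1:
-- c 0 = 1,  c n = - Σ_{j=1}^{n} E j * c (n - j).
-- invTable E n = [c n , c (n-1) , … , c 0].
private
  conv : FPS → ℕ → List ℚ → ℚ
  conv E i []       = 0ℚ
  conv E i (c ∷ cs) = E (suc i) * c + conv E (suc i) cs

invTable : FPS → ℕ → List ℚ
invTable E zero    = 1ℚ ∷ []
invTable E (suc n) = (- conv E 0 (invTable E n)) ∷ invTable E n

inv₁ : FPS → FPS
inv₁ E n with invTable E n
... | []    = 0ℚ
... | c ∷ _ = c

½ : ℚ
½ = + 1 / 2

-- D(t) = e_λ^{1/2}(t) - e_λ^{-1/2}(t); it has D 0 = 0 and D 1 = 1,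
-- so D(t) = t · E(t) with E(t) = Σ_k D (k+1) t^k and E 0 = 1.
Dλ : ℚ → FPS
Dλ lam k = eλ lam ½ k - eλ lam (- ½) k

-- t / (e_λ^{1/2}(t) - e_λ^{-1/2}(t)) = 1 / E(t)
genλ : ℚ → FPS
genλ lam = inv₁ (λ k → Dλ lam (suc k))

bpoly : ℕ → ℚ → ℚ → ℚ
bpoly n lam x = ι (n !) * (genλ lam ⊛ eλ lam x) n

bnum : ℕ → ℚ → ℚ
bnum n lam = bpoly n lam 0ℚ

{-# OPTIONS --safe #-}
-- Write D(t) = e_λ^{1/2}(t) − e_λ^{−1/2}(t) = t E(t) with E(0) = 1, so that the
-- generating function of the b_{n,λ}(x) is E(t)⁻¹ e_λ^x(t). Both e_λ^x e_λ^y and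
-- e_λ^{x+y} solve (1 + λt) f′ = (x + y) f with f(0) = 1, hence they agree, and so
-- D(t) Σ_{l<m} e_λ^{l+1/2}(t) telescopes to e_λ^m(t) − 1. Dividing by t E(t) gives
-- Σ_n (b_{n+1,λ}(m) − b_{n+1,λ}) tⁿ/(n+1)! = Σ_{l<m} e_λ^{l+1/2}(t), and comparing
-- coefficients finishes the proof since 2ⁿ (l + 1/2)_{n,λ} = (2l + 1)_{n,2λ}.

module Submission where

open import Defs
open import Data.Nat using (ℕ; zero; suc; _∸_; _!; _^_; NonZero)
import Data.Nat as ℕ
open import Data.Nat.Properties using (_!≢0)
import Data.Nat.Properties as ℕ
open import Data.Integer as ℤ using (+_)
import Data.Integer.Properties as ℤ
open import Data.Rational using (ℚ; 0ℚ; 1ℚ; _+_; _*_; _-_; -_; _/_; _≟_; toℚᵘ; fromℚᵘ)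
open import Data.Rational.Properties
import Data.Rational.Unnormalised as ℚᵘ
import Data.Rational.Unnormalised.Properties as ℚᵘ
open import Data.List using (List; map; foldr; applyUpTo)
open import Function using (_∘_)
open import Relation.Binary.PropositionalEquality
open import Relation.Nullary.Decidable using (dec⇒maybe)
open import Tactic.RingSolver using (solve-∀)
open import Tactic.RingSolver.Core.AlmostCommutativeRing using (AlmostCommutativeRing; fromCommutativeRing)

-- The zero test lets the normaliser discard vanishing coefficients.
ℚ-ring : AlmostCommutativeRing _ _
ℚ-ring = fromCommutativeRing +-*-commutativeRing (λ x → dec⇒maybe (0ℚ ≟ x))

fromℚᵘ-homo-+ : ∀ p q → fromℚᵘ (p ℚᵘ.+ q) ≡ fromℚᵘ p + fromℚᵘ q
fromℚᵘ-homo-+ p q = toℚᵘ-injective (begin-equality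
  toℚᵘ (fromℚᵘ (p ℚᵘ.+ q))            ≃⟨ toℚᵘ-fromℚᵘ (p ℚᵘ.+ q) ⟩
  p ℚᵘ.+ q                            ≃⟨ ℚᵘ.+-cong (ℚᵘ.≃-sym (toℚᵘ-fromℚᵘ p)) (ℚᵘ.≃-sym (toℚᵘ-fromℚᵘ q)) ⟩
  toℚᵘ (fromℚᵘ p) ℚᵘ.+ toℚᵘ (fromℚᵘ q) ≃⟨ ℚᵘ.≃-sym (toℚᵘ-homo-+ (fromℚᵘ p) (fromℚᵘ q)) ⟩
  toℚᵘ (fromℚᵘ p + fromℚᵘ q)          ∎)
  where open ℚᵘ.≤-Reasoning

fromℚᵘ-homo-* : ∀ p q → fromℚᵘ (p ℚᵘ.* q) ≡ fromℚᵘ p * fromℚᵘ q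
fromℚᵘ-homo-* p q = toℚᵘ-injective (begin-equality
  toℚᵘ (fromℚᵘ (p ℚᵘ.* q))            ≃⟨ toℚᵘ-fromℚᵘ (p ℚᵘ.* q) ⟩
  p ℚᵘ.* q                            ≃⟨ ℚᵘ.*-cong (ℚᵘ.≃-sym (toℚᵘ-fromℚᵘ p)) (ℚᵘ.≃-sym (toℚᵘ-fromℚᵘ q)) ⟩
  toℚᵘ (fromℚᵘ p) ℚᵘ.* toℚᵘ (fromℚᵘ q) ≃⟨ ℚᵘ.≃-sym (toℚᵘ-homo-* (fromℚᵘ p) (fromℚᵘ q)) ⟩
  toℚᵘ (fromℚᵘ p * fromℚᵘ q)          ∎)
  where open ℚᵘ.≤-Reasoning

-- ι n is definitionally fromℚᵘ (ιᵘ n).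
private
  ιᵘ : ℕ → ℚᵘ.ℚᵘ
  ιᵘ n = ℚᵘ.mkℚᵘ (+ n) 0

ι-+ : ∀ a b → ι (a ℕ.+ b) ≡ ι a + ι b
ι-+ a b = trans (fromℚᵘ-cong {ιᵘ (a ℕ.+ b)} {ιᵘ a ℚᵘ.+ ιᵘ b} (ℚᵘ.*≡* eq)) (fromℚᵘ-homo-+ (ιᵘ a) (ιᵘ b))
  where
  eq : + (a ℕ.+ b) ℤ.* + 1 ≡ (+ a ℤ.* + 1 ℤ.+ + b ℤ.* + 1) ℤ.* + 1
  eq = cong (ℤ._* + 1) (trans (ℤ.pos-+ a b) (sym (cong₂ ℤ._+_ (ℤ.*-identityʳ (+ a)) (ℤ.*-identityʳ (+ b)))))

ι-* : ∀ a b → ι (a ℕ.* b) ≡ ι a * ι b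
ι-* a b = trans (fromℚᵘ-cong {ιᵘ (a ℕ.* b)} {ιᵘ a ℚᵘ.* ιᵘ b} (ℚᵘ.*≡* eq)) (fromℚᵘ-homo-* (ιᵘ a) (ιᵘ b))
  where
  eq : + (a ℕ.* b) ℤ.* + 1 ≡ (+ a ℤ.* + b) ℤ.* + 1
  eq = cong (ℤ._* + 1) (ℤ.pos-* a b)

ι-suc : ∀ k → ι (suc k) ≡ 1ℚ + ι k
ι-suc k = ι-+ 1 k

[a/n]*n≡a : ∀ a n .{{_ : NonZero n}} → (+ a / n) * ι n ≡ ι a
[a/n]*n≡a a (suc m) = begin
  (+ a / suc m) * ι (suc m)           ≡⟨ fromℚᵘ-homo-* (ℚᵘ.mkℚᵘ (+ a) m) (ιᵘ (suc m)) ⟨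
  fromℚᵘ (ℚᵘ.mkℚᵘ (+ a) m ℚᵘ.* ιᵘ (suc m))  ≡⟨ fromℚᵘ-cong {ℚᵘ.mkℚᵘ (+ a) m ℚᵘ.* ιᵘ (suc m)} {ιᵘ a} (ℚᵘ.*≡* eq) ⟩
  ι a                                 ∎
  where
  open ≡-Reasoning
  eq : (+ a ℤ.* + suc m) ℤ.* + 1 ≡ + a ℤ.* (+ suc m ℤ.* + 1)
  eq = ℤ.*-assoc (+ a) (+ suc m) (+ 1)

*-cancelˡ-ι : ∀ n .{{_ : NonZero n}} {u v} → ι n * u ≡ ι n * v → u ≡ v
*-cancelˡ-ι n {u} {v} nu≡nv = begin
  u                        ≡⟨ unscale u ⟩
  (+ 1 / n) * (ι n * u)    ≡⟨ cong ((+ 1 / n) *_) nu≡nv ⟩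
  (+ 1 / n) * (ι n * v)    ≡⟨ unscale v ⟨
  v                        ∎
  where
  open ≡-Reasoning
  unscale : ∀ w → w ≡ (+ 1 / n) * (ι n * w)
  unscale w = begin
    w                       ≡⟨ *-identityˡ w ⟨
    1ℚ * w                  ≡⟨ cong (_* w) ([a/n]*n≡a 1 n) ⟨
    ((+ 1 / n) * ι n) * w   ≡⟨ *-assoc (+ 1 / n) (ι n) w ⟩
    (+ 1 / n) * (ι n * w)   ∎

1/! : ℕ → ℚ
1/! k = (+ 1 / (k !)) {{k !≢0}}

ι!*1/!≡1 : ∀ k → ι (k !) * 1/! k ≡ 1ℚ
ι!*1/!≡1 k = trans (*-comm (ι (k !)) (1/! k)) ([a/n]*n≡a 1 (k !) {{k !≢0}})

ι-suc*1/!-suc : ∀ k → ι (suc k) * 1/! (suc k) ≡ 1/! k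
ι-suc*1/!-suc k = *-cancelˡ-ι (k !) {{k !≢0}} (begin
  ι (k !) * (ι (suc k) * 1/! (suc k))  ≡⟨ *-assoc (ι (k !)) (ι (suc k)) (1/! (suc k)) ⟨
  (ι (k !) * ι (suc k)) * 1/! (suc k)  ≡⟨ cong (_* 1/! (suc k)) (*-comm (ι (k !)) (ι (suc k))) ⟩
  (ι (suc k) * ι (k !)) * 1/! (suc k)  ≡⟨ cong (_* 1/! (suc k)) (ι-* (suc k) (k !)) ⟨
  ι (suc k !) * 1/! (suc k)            ≡⟨ ι!*1/!≡1 (suc k) ⟩
  1ℚ                                   ≡⟨ ι!*1/!≡1 k ⟨
  ι (k !) * 1/! k                      ∎)
  where open ≡-Reasoning

[a/n+1]*[n+1]!*[1/n!]≡a : ∀ a n → (+ a / suc n) * ι (suc n !) * 1/! n ≡ ι a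
[a/n+1]*[n+1]!*[1/n!]≡a a n = begin
  (+ a / suc n) * ι (suc n ℕ.* n !) * 1/! n                 ≡⟨ cong (λ u → (+ a / suc n) * u * 1/! n) (ι-* (suc n) (n !)) ⟩
  (+ a / suc n) * (ι (suc n) * ι (n !)) * 1/! n             ≡⟨ regroup (+ a / suc n) (ι (suc n)) (ι (n !)) (1/! n) ⟩
  ((+ a / suc n) * ι (suc n)) * (ι (n !) * 1/! n)           ≡⟨ cong₂ _*_ ([a/n]*n≡a a (suc n)) (ι!*1/!≡1 n) ⟩
  ι a * 1ℚ                                                  ≡⟨ *-identityʳ (ι a) ⟩
  ι a                                                       ∎
  where
  open ≡-Reasoning
  regroup : ∀ q s f r → q * (s * f) * r ≡ (q * s) * (f * r)
  regroup = solve-∀ ℚ-ring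

∑ : ℕ → (ℕ → ℚ) → ℚ
∑ zero    f = 0ℚ
∑ (suc n) f = f 0 + ∑ n (f ∘ suc)

Σ<≡∑ : ∀ n f → Σ< n f ≡ ∑ n f
Σ<≡∑ n f = go n f (λ j → j)
  where
  go : ∀ n (f : ℕ → ℚ) g → foldr _+_ 0ℚ (map f (applyUpTo g n)) ≡ ∑ n (f ∘ g)
  go zero    f g = refl
  go (suc n) f g = cong (_+_ (f (g 0))) (go n f (g ∘ suc))

∑-cong : ∀ n {f g : ℕ → ℚ} → (∀ j → f j ≡ g j) → ∑ n f ≡ ∑ n g
∑-cong zero    f≡g = refl
∑-cong (suc n) f≡g = cong₂ _+_ (f≡g 0) (∑-cong n (f≡g ∘ suc))

∑-zero : ∀ n → ∑ n (λ _ → 0ℚ) ≡ 0ℚ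
∑-zero zero    = refl
∑-zero (suc n) = trans (+-identityˡ _) (∑-zero n)

∑-distrib-+ : ∀ n (f g : ℕ → ℚ) → ∑ n (λ j → f j + g j) ≡ ∑ n f + ∑ n g
∑-distrib-+ zero    f g = refl
∑-distrib-+ (suc n) f g =
  trans (cong (_+_ (f 0 + g 0)) (∑-distrib-+ n (f ∘ suc) (g ∘ suc))) (swap (f 0) (g 0) _ _)
  where
  swap : ∀ a b c d → (a + b) + (c + d) ≡ (a + c) + (b + d)
  swap = solve-∀ ℚ-ring

∑-distrib-- : ∀ n (f g : ℕ → ℚ) → ∑ n (λ j → f j - g j) ≡ ∑ n f - ∑ n g
∑-distrib-- zero    f g = refl
∑-distrib-- (suc n) f g =
  trans (cong (_+_ (f 0 - g 0)) (∑-distrib-- n (f ∘ suc) (g ∘ suc))) (swap (f 0) (g 0) _ _)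
  where
  swap : ∀ a b c d → (a - b) + (c - d) ≡ (a + c) - (b + d)
  swap = solve-∀ ℚ-ring

∑-*ˡ : ∀ n c (f : ℕ → ℚ) → ∑ n (λ j → c * f j) ≡ c * ∑ n f
∑-*ˡ zero    c f = sym (*-zeroʳ c)
∑-*ˡ (suc n) c f = trans (cong (_+_ (c * f 0)) (∑-*ˡ n c (f ∘ suc))) (sym (*-distribˡ-+ c (f 0) _))

∑-*ʳ : ∀ n c (f : ℕ → ℚ) → ∑ n (λ j → f j * c) ≡ ∑ n f * c
∑-*ʳ n c f = trans (∑-cong n (λ j → *-comm (f j) c)) (trans (∑-*ˡ n c f) (*-comm c (∑ n f)))

∑-snoc : ∀ n (f : ℕ → ℚ) → ∑ (suc n) f ≡ ∑ n f + f n
∑-snoc zero    f = trans (+-identityʳ (f 0)) (sym (+-identityˡ (f 0)))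
∑-snoc (suc n) f = trans (cong (_+_ (f 0)) (∑-snoc n (f ∘ suc))) (sym (+-assoc (f 0) _ _))

∑-telescope : ∀ n (h : ℕ → ℚ) → ∑ n (λ l → h (suc l) - h l) ≡ h n - h 0
∑-telescope zero    h = sym (+-inverseʳ (h 0))
∑-telescope (suc n) h = begin
  ∑ (suc n) (λ l → h (suc l) - h l)      ≡⟨ ∑-snoc n (λ l → h (suc l) - h l) ⟩
  ∑ n (λ l → h (suc l) - h l) + (h (suc n) - h n) ≡⟨ cong (_+ (h (suc n) - h n)) (∑-telescope n h) ⟩
  (h n - h 0) + (h (suc n) - h n)         ≡⟨ cancel (h n) (h (suc n)) (h 0) ⟩
  h (suc n) - h 0                         ∎
  where
  open ≡-Reasoning
  cancel : ∀ a b c → (a - c) + (b - a) ≡ b - c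
  cancel = solve-∀ ℚ-ring

-- Cauchy products

infix 4 _≐_
infixl 6 _⊕_ _⊖_
infixl 7 _⊙_

_≐_ : FPS → FPS → Set
f ≐ g = ∀ k → f k ≡ g k

_⊕_ _⊖_ : FPS → FPS → FPS
(f ⊕ g) k = f k + g k
(f ⊖ g) k = f k - g k

_⊙_ : ℚ → FPS → FPS
(c ⊙ f) k = c * f k

tail : FPS → FPS
tail f k = f (suc k)

𝟙 : FPS
𝟙 zero    = 1ℚ
𝟙 (suc k) = 0ℚ

-- The Euler operator t d/dt.
θ : FPS → FPS
θ f k = ι k * f k

⊛-as-∑ : ∀ f g n → (f ⊛ g) n ≡ ∑ (suc n) (λ j → f j * g (n ∸ j))
⊛-as-∑ f g n = Σ<≡∑ (suc n) (λ j → f j * g (n ∸ j))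

⊛-at-0 : ∀ f g → (f ⊛ g) 0 ≡ f 0 * g 0
⊛-at-0 f g = trans (⊛-as-∑ f g 0) (+-identityʳ (f 0 * g 0))

⊛-suc : ∀ f g n → (f ⊛ g) (suc n) ≡ f 0 * g (suc n) + (tail f ⊛ g) n
⊛-suc f g n = trans (⊛-as-∑ f g (suc n)) (cong (_+_ (f 0 * g (suc n))) (sym (⊛-as-∑ (tail f) g n)))

⊛-sucʳ : ∀ f g n → (f ⊛ g) (suc n) ≡ (f ⊛ tail g) n + f (suc n) * g 0
⊛-sucʳ f g zero = begin
  (f ⊛ g) 1                       ≡⟨ ⊛-suc f g 0 ⟩
  f 0 * g 1 + (tail f ⊛ g) 0      ≡⟨ cong₂ _+_ (sym (⊛-at-0 f (tail g))) (⊛-at-0 (tail f) g) ⟩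
  (f ⊛ tail g) 0 + f 1 * g 0      ∎
  where open ≡-Reasoning
⊛-sucʳ f g (suc n) = begin
  (f ⊛ g) (suc (suc n))                                       ≡⟨ ⊛-suc f g (suc n) ⟩
  f 0 * g (suc (suc n)) + (tail f ⊛ g) (suc n)                ≡⟨ cong (_+_ (f 0 * g (suc (suc n)))) (⊛-sucʳ (tail f) g n) ⟩
  f 0 * g (suc (suc n)) + ((tail f ⊛ tail g) n + f (suc (suc n)) * g 0)
    ≡⟨ +-assoc (f 0 * g (suc (suc n))) ((tail f ⊛ tail g) n) (f (suc (suc n)) * g 0) ⟨
  (f 0 * g (suc (suc n)) + (tail f ⊛ tail g) n) + f (suc (suc n)) * g 0
    ≡⟨ cong (_+ f (suc (suc n)) * g 0) (⊛-suc f (tail g) n) ⟨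
  (f ⊛ tail g) (suc n) + f (suc (suc n)) * g 0                ∎
  where open ≡-Reasoning

⊛-congˡ : ∀ {f f′} g → f ≐ f′ → f ⊛ g ≐ f′ ⊛ g
⊛-congˡ {f} {f′} g f≐f′ n = begin
  (f ⊛ g) n                            ≡⟨ ⊛-as-∑ f g n ⟩
  ∑ (suc n) (λ j → f j * g (n ∸ j))    ≡⟨ ∑-cong (suc n) (λ j → cong (_* g (n ∸ j)) (f≐f′ j)) ⟩
  ∑ (suc n) (λ j → f′ j * g (n ∸ j))   ≡⟨ ⊛-as-∑ f′ g n ⟨
  (f′ ⊛ g) n                           ∎
  where open ≡-Reasoning

⊛-comm : ∀ f g → f ⊛ g ≐ g ⊛ f
⊛-comm f g zero    = trans (⊛-at-0 f g) (trans (*-comm (f 0) (g 0)) (sym (⊛-at-0 g f)))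
⊛-comm f g (suc n) = begin
  (f ⊛ g) (suc n)                     ≡⟨ ⊛-suc f g n ⟩
  f 0 * g (suc n) + (tail f ⊛ g) n    ≡⟨ cong₂ _+_ (*-comm (f 0) (g (suc n))) (⊛-comm (tail f) g n) ⟩
  g (suc n) * f 0 + (g ⊛ tail f) n    ≡⟨ +-comm (g (suc n) * f 0) ((g ⊛ tail f) n) ⟩
  (g ⊛ tail f) n + g (suc n) * f 0    ≡⟨ ⊛-sucʳ g f n ⟨
  (g ⊛ f) (suc n)                     ∎
  where open ≡-Reasoning

⊛-congʳ : ∀ f {g g′} → g ≐ g′ → f ⊛ g ≐ f ⊛ g′
⊛-congʳ f {g} {g′} g≐g′ n =
  trans (⊛-comm f g n) (trans (⊛-congˡ f g≐g′ n) (⊛-comm g′ f n))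

module _ (f g h : FPS) where
  private
    term : FPS → ℕ → ℕ → ℚ
    term u n j = u j * h (n ∸ j)

  ⊛-distribʳ-⊕ : (f ⊕ g) ⊛ h ≐ f ⊛ h ⊕ g ⊛ h
  ⊛-distribʳ-⊕ n = begin
    ((f ⊕ g) ⊛ h) n                                 ≡⟨ ⊛-as-∑ (f ⊕ g) h n ⟩
    ∑ (suc n) (λ j → (f j + g j) * h (n ∸ j))       ≡⟨ ∑-cong (suc n) (λ j → *-distribʳ-+ (h (n ∸ j)) (f j) (g j)) ⟩
    ∑ (suc n) (λ j → term f n j + term g n j)           ≡⟨ ∑-distrib-+ (suc n) (term f n) (term g n) ⟩
    ∑ (suc n) (term f n) + ∑ (suc n) (term g n)         ≡⟨ cong₂ _+_ (⊛-as-∑ f h n) (⊛-as-∑ g h n) ⟨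
    (f ⊛ h) n + (g ⊛ h) n                           ∎
    where open ≡-Reasoning

  ⊛-distribʳ-⊖ : (f ⊖ g) ⊛ h ≐ f ⊛ h ⊖ g ⊛ h
  ⊛-distribʳ-⊖ n = begin
    ((f ⊖ g) ⊛ h) n                                 ≡⟨ ⊛-as-∑ (f ⊖ g) h n ⟩
    ∑ (suc n) (λ j → (f j - g j) * h (n ∸ j))       ≡⟨ ∑-cong (suc n) (λ j → distrib (f j) (g j) (h (n ∸ j))) ⟩
    ∑ (suc n) (λ j → term f n j - term g n j)           ≡⟨ ∑-distrib-- (suc n) (term f n) (term g n) ⟩
    ∑ (suc n) (term f n) - ∑ (suc n) (term g n)         ≡⟨ cong₂ _-_ (⊛-as-∑ f h n) (⊛-as-∑ g h n) ⟨
    (f ⊛ h) n - (g ⊛ h) n                           ∎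
    where
    open ≡-Reasoning
    distrib : ∀ a b c → (a - b) * c ≡ a * c - b * c
    distrib = solve-∀ ℚ-ring

⊛-distribˡ-⊖ : ∀ f g h → f ⊛ (g ⊖ h) ≐ f ⊛ g ⊖ f ⊛ h
⊛-distribˡ-⊖ f g h n = begin
  (f ⊛ (g ⊖ h)) n         ≡⟨ ⊛-comm f (g ⊖ h) n ⟩
  ((g ⊖ h) ⊛ f) n         ≡⟨ ⊛-distribʳ-⊖ g h f n ⟩
  (g ⊛ f) n - (h ⊛ f) n   ≡⟨ cong₂ _-_ (⊛-comm g f n) (⊛-comm h f n) ⟩
  (f ⊛ g) n - (f ⊛ h) n   ∎
  where open ≡-Reasoning

⊛-*ˡ : ∀ c f g → (c ⊙ f) ⊛ g ≐ c ⊙ (f ⊛ g)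
⊛-*ˡ c f g n = begin
  ((c ⊙ f) ⊛ g) n                            ≡⟨ ⊛-as-∑ (c ⊙ f) g n ⟩
  ∑ (suc n) (λ j → c * f j * g (n ∸ j))      ≡⟨ ∑-cong (suc n) (λ j → *-assoc c (f j) (g (n ∸ j))) ⟩
  ∑ (suc n) (λ j → c * (f j * g (n ∸ j)))    ≡⟨ ∑-*ˡ (suc n) c (λ j → f j * g (n ∸ j)) ⟩
  c * ∑ (suc n) (λ j → f j * g (n ∸ j))      ≡⟨ cong (c *_) (⊛-as-∑ f g n) ⟨
  c * (f ⊛ g) n                              ∎
  where open ≡-Reasoning

⊛-∑ʳ : ∀ m f (g : ℕ → FPS) n → (f ⊛ (λ k → ∑ m (λ l → g l k))) n ≡ ∑ m (λ l → (f ⊛ g l) n)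
⊛-∑ʳ zero f g n = begin
  (f ⊛ (λ _ → 0ℚ)) n                ≡⟨ ⊛-as-∑ f (λ _ → 0ℚ) n ⟩
  ∑ (suc n) (λ j → f j * 0ℚ)        ≡⟨ ∑-cong (suc n) (λ j → *-zeroʳ (f j)) ⟩
  ∑ (suc n) (λ _ → 0ℚ)              ≡⟨ ∑-zero (suc n) ⟩
  0ℚ                                ∎
  where open ≡-Reasoning
⊛-∑ʳ (suc m) f g n = begin
  (f ⊛ (g 0 ⊕ rest)) n                          ≡⟨ ⊛-comm f (g 0 ⊕ rest) n ⟩
  ((g 0 ⊕ rest) ⊛ f) n                          ≡⟨ ⊛-distribʳ-⊕ (g 0) rest f n ⟩
  (g 0 ⊛ f) n + (rest ⊛ f) n                    ≡⟨ cong₂ _+_ (⊛-comm (g 0) f n) (⊛-comm rest f n) ⟩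
  (f ⊛ g 0) n + (f ⊛ rest) n                    ≡⟨ cong (_+_ ((f ⊛ g 0) n)) (⊛-∑ʳ m f (g ∘ suc) n) ⟩
  (f ⊛ g 0) n + ∑ m (λ l → (f ⊛ g (suc l)) n)   ∎
  where
  open ≡-Reasoning
  rest : FPS
  rest k = ∑ m (λ l → g (suc l) k)

⊛-identityˡ : ∀ f → 𝟙 ⊛ f ≐ f
⊛-identityˡ f n = begin
  (𝟙 ⊛ f) n                                  ≡⟨ ⊛-as-∑ 𝟙 f n ⟩
  1ℚ * f n + ∑ n (λ j → 0ℚ * f (n ∸ suc j))   ≡⟨ cong (_+_ (1ℚ * f n)) (∑-cong n (λ j → *-zeroˡ (f (n ∸ suc j)))) ⟩
  1ℚ * f n + ∑ n (λ _ → 0ℚ)                  ≡⟨ cong₂ _+_ (*-identityˡ (f n)) (∑-zero n) ⟩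
  f n + 0ℚ                                   ≡⟨ +-identityʳ (f n) ⟩
  f n                                        ∎
  where open ≡-Reasoning

⊛-assoc : ∀ f g h → (f ⊛ g) ⊛ h ≐ f ⊛ (g ⊛ h)
⊛-assoc f g h zero = begin
  ((f ⊛ g) ⊛ h) 0       ≡⟨ ⊛-at-0 (f ⊛ g) h ⟩
  (f ⊛ g) 0 * h 0       ≡⟨ cong (_* h 0) (⊛-at-0 f g) ⟩
  f 0 * g 0 * h 0       ≡⟨ *-assoc (f 0) (g 0) (h 0) ⟩
  f 0 * (g 0 * h 0)     ≡⟨ cong (f 0 *_) (⊛-at-0 g h) ⟨
  f 0 * (g ⊛ h) 0       ≡⟨ ⊛-at-0 f (g ⊛ h) ⟨
  (f ⊛ (g ⊛ h)) 0       ∎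
  where open ≡-Reasoning
⊛-assoc f g h (suc n) = begin
  ((f ⊛ g) ⊛ h) (suc n)                                     ≡⟨ ⊛-suc (f ⊛ g) h n ⟩
  (f ⊛ g) 0 * h (suc n) + (tail (f ⊛ g) ⊛ h) n              ≡⟨ cong₂ _+_ (cong (_* h (suc n)) (⊛-at-0 f g)) (⊛-congˡ h (⊛-suc f g) n) ⟩
  f 0 * g 0 * h (suc n) + ((f 0 ⊙ tail g ⊕ tail f ⊛ g) ⊛ h) n
    ≡⟨ cong (_+_ (f 0 * g 0 * h (suc n))) (⊛-distribʳ-⊕ (f 0 ⊙ tail g) (tail f ⊛ g) h n) ⟩
  f 0 * g 0 * h (suc n) + (((f 0 ⊙ tail g) ⊛ h) n + ((tail f ⊛ g) ⊛ h) n)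
    ≡⟨ cong (_+_ (f 0 * g 0 * h (suc n))) (cong₂ _+_ (⊛-*ˡ (f 0) (tail g) h n) (⊛-assoc (tail f) g h n)) ⟩
  f 0 * g 0 * h (suc n) + (f 0 * (tail g ⊛ h) n + (tail f ⊛ (g ⊛ h)) n)
    ≡⟨ regroup (f 0) (g 0) (h (suc n)) ((tail g ⊛ h) n) ((tail f ⊛ (g ⊛ h)) n) ⟩
  f 0 * (g 0 * h (suc n) + (tail g ⊛ h) n) + (tail f ⊛ (g ⊛ h)) n
    ≡⟨ cong (λ u → f 0 * u + (tail f ⊛ (g ⊛ h)) n) (⊛-suc g h n) ⟨
  f 0 * (g ⊛ h) (suc n) + (tail f ⊛ (g ⊛ h)) n              ≡⟨ ⊛-suc f (g ⊛ h) n ⟨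
  (f ⊛ (g ⊛ h)) (suc n)                                     ∎
  where
  open ≡-Reasoning
  regroup : ∀ a b c d e → a * b * c + (a * d + e) ≡ a * (b * c + d) + e
  regroup = solve-∀ ℚ-ring

tail-θ : ∀ f → tail (θ f) ≐ tail f ⊕ θ (tail f)
tail-θ f k = begin
  ι (suc k) * f (suc k)                  ≡⟨ cong (_* f (suc k)) (ι-suc k) ⟩
  (1ℚ + ι k) * f (suc k)                 ≡⟨ *-distribʳ-+ (f (suc k)) 1ℚ (ι k) ⟩
  1ℚ * f (suc k) + ι k * f (suc k)       ≡⟨ cong (_+ ι k * f (suc k)) (*-identityˡ (f (suc k))) ⟩
  f (suc k) + ι k * f (suc k)            ∎
  where open ≡-Reasoning

θ-leibniz : ∀ f g → θ (f ⊛ g) ≐ θ f ⊛ g ⊕ f ⊛ θ g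
θ-leibniz f g zero = begin
  0ℚ * (f ⊛ g) 0                      ≡⟨ *-zeroˡ ((f ⊛ g) 0) ⟩
  0ℚ                                  ≡⟨ zeros (f 0) (g 0) ⟩
  0ℚ * f 0 * g 0 + f 0 * (0ℚ * g 0)   ≡⟨ cong₂ _+_ (⊛-at-0 (θ f) g) (⊛-at-0 f (θ g)) ⟨
  (θ f ⊛ g) 0 + (f ⊛ θ g) 0           ∎
  where
  open ≡-Reasoning
  zeros : ∀ a b → 0ℚ ≡ 0ℚ * a * b + a * (0ℚ * b)
  zeros = solve-∀ ℚ-ring
θ-leibniz f g (suc n) = begin
  ι (suc n) * (f ⊛ g) (suc n)                     ≡⟨ cong₂ _*_ (ι-suc n) (⊛-suc f g n) ⟩
  (1ℚ + ι n) * (f 0 * g (suc n) + A)              ≡⟨ expand (ι n) (f 0) (g (suc n)) A ⟩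
  f 0 * ((1ℚ + ι n) * g (suc n)) + (A + ι n * A)
    ≡⟨ cong₂ (λ u v → f 0 * (u * g (suc n)) + (A + v)) (sym (ι-suc n)) (θ-leibniz (tail f) g n) ⟩
  f 0 * θ g (suc n) + (A + (B + C))               ≡⟨ regroup (f 0) (g (suc n)) A B (f 0 * θ g (suc n)) C ⟩
  (ι 0 * f 0 * g (suc n) + (A + B)) + (f 0 * θ g (suc n) + C)
    ≡⟨ cong (λ u → (ι 0 * f 0 * g (suc n) + u) + (f 0 * θ g (suc n) + C)) (⊛-distribʳ-⊕ (tail f) (θ (tail f)) g n) ⟨
  (θ f 0 * g (suc n) + ((tail f ⊕ θ (tail f)) ⊛ g) n) + (f 0 * θ g (suc n) + C)
    ≡⟨ cong (λ u → (θ f 0 * g (suc n) + u) + (f 0 * θ g (suc n) + C)) (⊛-congˡ g (tail-θ f) n) ⟨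
  (θ f 0 * g (suc n) + (tail (θ f) ⊛ g) n) + (f 0 * θ g (suc n) + C)
    ≡⟨ cong₂ _+_ (⊛-suc (θ f) g n) (⊛-suc f (θ g) n) ⟨
  (θ f ⊛ g) (suc n) + (f ⊛ θ g) (suc n)           ∎
  where
  open ≡-Reasoning
  A = (tail f ⊛ g) n
  B = (θ (tail f) ⊛ g) n
  C = (tail f ⊛ θ g) n
  expand : ∀ i a b c → (1ℚ + i) * (a * b + c) ≡ a * ((1ℚ + i) * b) + (c + i * c)
  expand = solve-∀ ℚ-ring
  regroup : ∀ a b c d e f → e + (c + (d + f)) ≡ (0ℚ * a * b + (c + d)) + (e + f)
  regroup = solve-∀ ℚ-ring

tail-⊛ˡ : ∀ f g → f 0 ≡ 0ℚ → tail (f ⊛ g) ≐ tail f ⊛ g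
tail-⊛ˡ f g f0≡0 n = begin
  (f ⊛ g) (suc n)                     ≡⟨ ⊛-suc f g n ⟩
  f 0 * g (suc n) + (tail f ⊛ g) n    ≡⟨ cong (λ u → u * g (suc n) + (tail f ⊛ g) n) f0≡0 ⟩
  0ℚ * g (suc n) + (tail f ⊛ g) n     ≡⟨ cong (_+ (tail f ⊛ g) n) (*-zeroˡ (g (suc n))) ⟩
  0ℚ + (tail f ⊛ g) n                 ≡⟨ +-identityˡ ((tail f ⊛ g) n) ⟩
  (tail f ⊛ g) n                      ∎
  where open ≡-Reasoning

tail-⊛ʳ : ∀ f g → g 0 ≡ 0ℚ → tail (f ⊛ g) ≐ f ⊛ tail g
tail-⊛ʳ f g g0≡0 n = begin
  (f ⊛ g) (suc n)      ≡⟨ ⊛-comm f g (suc n) ⟩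
  (g ⊛ f) (suc n)      ≡⟨ tail-⊛ˡ g f g0≡0 n ⟩
  (tail g ⊛ f) n       ≡⟨ ⊛-comm (tail g) f n ⟩
  (f ⊛ tail g) n       ∎
  where open ≡-Reasoning

-- The recursion defining inv₁ goes through a helper that Defs keeps private;
-- unification recovers it as the solution of the metavariable `convolve`
-- (abstracting invTable E n and 0 makes the constraint a higher-order pattern).
private
  mutual
    convolve : FPS → ℕ → List ℚ → ℚ
    convolve = _

    inv₁-suc : ∀ E n → inv₁ E (suc n) ≡ - convolve E 0 (invTable E n)
    inv₁-suc E n with invTable E n | 0
    ... | cs | i = refl

convolve-invTable : ∀ E n i → convolve E i (invTable E n) ≡ ∑ (suc n) (λ j → E (suc (j ℕ.+ i)) * inv₁ E (n ∸ j))
convolve-invTable E zero    i = refl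
convolve-invTable E (suc n) i =
  cong (_+_ (E (suc i) * inv₁ E (suc n)))
    (trans (convolve-invTable E n (suc i))
           (∑-cong (suc n) (λ j → cong (λ k → E (suc k) * inv₁ E (n ∸ j)) (ℕ.+-suc j i))))

inv₁-inverseʳ : ∀ E → E 0 ≡ 1ℚ → E ⊛ inv₁ E ≐ 𝟙
inv₁-inverseʳ E E0≡1 zero    = trans (⊛-at-0 E (inv₁ E)) (trans (cong (_* 1ℚ) E0≡1) (*-identityˡ 1ℚ))
inv₁-inverseʳ E E0≡1 (suc n) = begin
  (E ⊛ inv₁ E) (suc n)                       ≡⟨ ⊛-suc E (inv₁ E) n ⟩
  E 0 * inv₁ E (suc n) + (tail E ⊛ inv₁ E) n ≡⟨ cong₂ (λ u v → u * v + (tail E ⊛ inv₁ E) n) E0≡1 (inv₁-suc E n) ⟩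
  1ℚ * - X + (tail E ⊛ inv₁ E) n              ≡⟨ cong (_+_ (1ℚ * - X)) tail-E⊛inv₁≡X ⟩
  1ℚ * - X + X                               ≡⟨ cancel X ⟩
  0ℚ                                         ∎
  where
  open ≡-Reasoning
  X = convolve E 0 (invTable E n)
  tail-E⊛inv₁≡X : (tail E ⊛ inv₁ E) n ≡ X
  tail-E⊛inv₁≡X = begin
    (tail E ⊛ inv₁ E) n                                   ≡⟨ ⊛-as-∑ (tail E) (inv₁ E) n ⟩
    ∑ (suc n) (λ j → E (suc j) * inv₁ E (n ∸ j))          ≡⟨ ∑-cong (suc n) (λ j → cong (λ k → E (suc k) * inv₁ E (n ∸ j)) (ℕ.+-identityʳ j)) ⟨
    ∑ (suc n) (λ j → E (suc (j ℕ.+ 0)) * inv₁ E (n ∸ j))  ≡⟨ convolve-invTable E n 0 ⟨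
    X                                                     ∎
  cancel : ∀ x → 1ℚ * - x + x ≡ 0ℚ
  cancel = solve-∀ ℚ-ring

-- Degenerate exponentials

-- Coefficientwise form of (1 + λt) f′ = x f, the differential equation of e_λ^x(t).
record DegExpODE (lam x : ℚ) (f : FPS) : Set where
  constructor degExpODE
  field recurrence : ∀ k → ι (suc k) * f (suc k) ≡ f k * (x - ι k * lam)

open DegExpODE

eλ-ode : ∀ lam x → DegExpODE lam x (eλ lam x)
eλ-ode lam x = degExpODE step
  where
  step : ∀ k → ι (suc k) * eλ lam x (suc k) ≡ eλ lam x k * (x - ι k * lam)
  step k = begin
    ι (suc k) * (fall x k lam * (x - ι k * lam) * 1/! (suc k))  ≡⟨ reorder (ι (suc k)) (fall x k lam) (x - ι k * lam) (1/! (suc k)) ⟩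
    fall x k lam * (ι (suc k) * 1/! (suc k)) * (x - ι k * lam)  ≡⟨ cong (λ u → fall x k lam * u * (x - ι k * lam)) (ι-suc*1/!-suc k) ⟩
    fall x k lam * 1/! k * (x - ι k * lam)                      ∎
    where
    open ≡-Reasoning
    reorder : ∀ a f y b → a * (f * y * b) ≡ f * (a * b) * y
    reorder = solve-∀ ℚ-ring

degExpODE-unique : ∀ {lam x f} → DegExpODE lam x f → f 0 ≡ 1ℚ → f ≐ eλ lam x
degExpODE-unique ode f0≡1 zero    = f0≡1
degExpODE-unique {lam} {x} {f} ode f0≡1 (suc k) = *-cancelˡ-ι (suc k) (begin
  ι (suc k) * f (suc k)             ≡⟨ recurrence ode k ⟩
  f k * (x - ι k * lam)             ≡⟨ cong (_* (x - ι k * lam)) (degExpODE-unique ode f0≡1 k) ⟩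
  eλ lam x k * (x - ι k * lam)      ≡⟨ recurrence (eλ-ode lam x) k ⟨
  ι (suc k) * eλ lam x (suc k)      ∎)
  where open ≡-Reasoning

DegExpODE⇒tail-θ : ∀ {lam x f} → DegExpODE lam x f → tail (θ f) ≐ x ⊙ f ⊖ lam ⊙ θ f
DegExpODE⇒tail-θ {lam} {x} {f} ode k = trans (recurrence ode k) (expand (f k) x (ι k) lam)
  where
  expand : ∀ a y i l → a * (y - i * l) ≡ y * a - l * (i * a)
  expand = solve-∀ ℚ-ring

DegExpODE⇒θ⊛-suc : ∀ {lam x f} → DegExpODE lam x f → ∀ g n →
            (θ f ⊛ g) (suc n) ≡ x * (f ⊛ g) n - lam * (θ f ⊛ g) n
DegExpODE⇒θ⊛-suc {lam} {x} {f} ode g n = begin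
  (θ f ⊛ g) (suc n)                                  ≡⟨ tail-⊛ˡ (θ f) g (*-zeroˡ (f 0)) n ⟩
  (tail (θ f) ⊛ g) n                                 ≡⟨ ⊛-congˡ g (DegExpODE⇒tail-θ ode) n ⟩
  ((x ⊙ f ⊖ lam ⊙ θ f) ⊛ g) n                        ≡⟨ ⊛-distribʳ-⊖ (x ⊙ f) (lam ⊙ θ f) g n ⟩
  ((x ⊙ f) ⊛ g) n - ((lam ⊙ θ f) ⊛ g) n              ≡⟨ cong₂ _-_ (⊛-*ˡ x f g n) (⊛-*ˡ lam (θ f) g n) ⟩
  x * (f ⊛ g) n - lam * (θ f ⊛ g) n                  ∎
  where open ≡-Reasoning

degExpODE-⊛ : ∀ {lam x y f g} → DegExpODE lam x f → DegExpODE lam y g → DegExpODE lam (x + y) (f ⊛ g)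
degExpODE-⊛ {lam} {x} {y} {f} {g} odef odeg = degExpODE step
  where
  step : ∀ k → ι (suc k) * (f ⊛ g) (suc k) ≡ (f ⊛ g) k * (x + y - ι k * lam)
  step k = begin
    θ (f ⊛ g) (suc k)                                  ≡⟨ θ-leibniz f g (suc k) ⟩
    (θ f ⊛ g) (suc k) + (f ⊛ θ g) (suc k)              ≡⟨ cong (_+_ ((θ f ⊛ g) (suc k))) (⊛-comm f (θ g) (suc k)) ⟩
    (θ f ⊛ g) (suc k) + (θ g ⊛ f) (suc k)              ≡⟨ cong₂ _+_ (DegExpODE⇒θ⊛-suc odef g k) (DegExpODE⇒θ⊛-suc odeg f k) ⟩
    (x * c - lam * P) + (y * (g ⊛ f) k - lam * (θ g ⊛ f) k)
      ≡⟨ cong₂ (λ u v → (x * c - lam * P) + (y * u - lam * v)) (⊛-comm g f k) (⊛-comm (θ g) f k) ⟩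
    (x * c - lam * P) + (y * c - lam * Q)              ≡⟨ collect x y lam c P Q ⟩
    c * (x + y) - lam * (P + Q)                        ≡⟨ cong (λ u → c * (x + y) - lam * u) (θ-leibniz f g k) ⟨
    c * (x + y) - lam * (ι k * c)                      ≡⟨ factor c (x + y) lam (ι k) ⟩
    c * (x + y - ι k * lam)                            ∎
    where
    open ≡-Reasoning
    c = (f ⊛ g) k
    P = (θ f ⊛ g) k
    Q = (f ⊛ θ g) k
    collect : ∀ x y l c p q → (x * c - l * p) + (y * c - l * q) ≡ c * (x + y) - l * (p + q)
    collect = solve-∀ ℚ-ring
    factor : ∀ c z l i → c * z - l * (i * c) ≡ c * (z - i * l)
    factor = solve-∀ ℚ-ring

eλ-+ : ∀ lam x y → eλ lam x ⊛ eλ lam y ≐ eλ lam (x + y)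
eλ-+ lam x y = degExpODE-unique (degExpODE-⊛ (eλ-ode lam x) (eλ-ode lam y))
  (trans (⊛-at-0 (eλ lam x) (eλ lam y)) (*-identityˡ 1ℚ))

fall-scale : ∀ c n x lam → ι (c ^ n) * fall x n lam ≡ fall (ι c * x) n (ι c * lam)
fall-scale c zero    x lam = refl
fall-scale c (suc n) x lam = begin
  ι (c ℕ.* c ^ n) * (fall x n lam * (x - ι n * lam))
    ≡⟨ cong (_* (fall x n lam * (x - ι n * lam))) (ι-* c (c ^ n)) ⟩
  ι c * ι (c ^ n) * (fall x n lam * (x - ι n * lam))
    ≡⟨ distribute (ι c) (ι (c ^ n)) (fall x n lam) x (ι n) lam ⟩
  ι (c ^ n) * fall x n lam * (ι c * x - ι n * (ι c * lam))
    ≡⟨ cong (_* (ι c * x - ι n * (ι c * lam))) (fall-scale c n x lam) ⟩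
  fall (ι c * x) n (ι c * lam) * (ι c * x - ι n * (ι c * lam))
    ∎
  where
  open ≡-Reasoning
  distribute : ∀ c p f x i l → c * p * (f * (x - i * l)) ≡ p * f * (c * x - i * (c * l))
  distribute = solve-∀ ℚ-ring

odd≡2*[l+½] : ∀ l → ι (2 ℕ.* l ℕ.+ 1) ≡ ι 2 * (ι l + ½)
odd≡2*[l+½] l = begin
  ι (2 ℕ.* l ℕ.+ 1)   ≡⟨ ι-+ (2 ℕ.* l) 1 ⟩
  ι (2 ℕ.* l) + 1ℚ    ≡⟨ cong (_+ 1ℚ) (ι-* 2 l) ⟩
  ι 2 * ι l + 1ℚ      ≡⟨ halve (ι l) ⟩
  ι 2 * (ι l + ½)     ∎
  where
  open ≡-Reasoning
  halve : ∀ a → ι 2 * a + 1ℚ ≡ ι 2 * (a + ½)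
  halve = solve-∀ ℚ-ring

-- The generating function of b_{n,λ}

module _ (lam : ℚ) where
  private
    e : ℚ → FPS
    e = eλ lam

  Dλ-at-0 : Dλ lam 0 ≡ 0ℚ
  Dλ-at-0 = refl

  Dλ-at-1 : Dλ lam 1 ≡ 1ℚ
  Dλ-at-1 = unfolded lam
    where
    unfolded : ∀ l → 1ℚ * (½ - 0ℚ * l) * 1ℚ - 1ℚ * (- ½ - 0ℚ * l) * 1ℚ ≡ 1ℚ
    unfolded = solve-∀ ℚ-ring

  genλ-⊛-tail-Dλ : genλ lam ⊛ tail (Dλ lam) ≐ 𝟙
  genλ-⊛-tail-Dλ k = trans (⊛-comm (genλ lam) (tail (Dλ lam)) k) (inv₁-inverseʳ (tail (Dλ lam)) Dλ-at-1 k)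

  Dλ-⊛-eλ : ∀ z → Dλ lam ⊛ e z ≐ e (½ + z) ⊖ e (- ½ + z)
  Dλ-⊛-eλ z k = trans (⊛-distribʳ-⊖ (e ½) (e (- ½)) (e z) k) (cong₂ _-_ (eλ-+ lam ½ z k) (eλ-+ lam (- ½) z k))

  halfIntegerSum : ℕ → FPS
  halfIntegerSum m k = ∑ m (λ l → e (ι l + ½) k)

  Dλ-⊛-halfIntegerSum : ∀ m → Dλ lam ⊛ halfIntegerSum m ≐ e (ι m) ⊖ e 0ℚ
  Dλ-⊛-halfIntegerSum m k = begin
    (Dλ lam ⊛ halfIntegerSum m) k                               ≡⟨ ⊛-∑ʳ m (Dλ lam) (λ l → e (ι l + ½)) k ⟩
    ∑ m (λ l → (Dλ lam ⊛ e (ι l + ½)) k)                        ≡⟨ ∑-cong m (λ l → Dλ-⊛-eλ (ι l + ½) k) ⟩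
    ∑ m (λ l → e (½ + (ι l + ½)) k - e (- ½ + (ι l + ½)) k)     ≡⟨ ∑-cong m (λ l → cong₂ (λ u v → e u k - e v k) (up l) (down (ι l))) ⟩
    ∑ m (λ l → e (ι (suc l)) k - e (ι l) k)                     ≡⟨ ∑-telescope m (λ l → e (ι l) k) ⟩
    e (ι m) k - e 0ℚ k                                          ∎
    where
    open ≡-Reasoning
    down : ∀ a → - ½ + (a + ½) ≡ a
    down = solve-∀ ℚ-ring
    half+half : ∀ a → ½ + (a + ½) ≡ 1ℚ + a
    half+half = solve-∀ ℚ-ring
    up : ∀ l → ½ + (ι l + ½) ≡ ι (suc l)
    up l = trans (half+half (ι l)) (sym (ι-suc l))

  genλ-⊛-eλ-difference : ∀ m n → (genλ lam ⊛ (e (ι m) ⊖ e 0ℚ)) (suc n) ≡ halfIntegerSum m n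
  genλ-⊛-eλ-difference m n = begin
    (G ⊛ (e (ι m) ⊖ e 0ℚ)) (suc n)   ≡⟨ ⊛-congʳ G (Dλ-⊛-halfIntegerSum m) (suc n) ⟨
    (G ⊛ (D ⊛ S)) (suc n)            ≡⟨ tail-⊛ʳ G (D ⊛ S) D⊛S-at-0 n ⟩
    (G ⊛ tail (D ⊛ S)) n             ≡⟨ ⊛-congʳ G (tail-⊛ˡ D S Dλ-at-0) n ⟩
    (G ⊛ (tail D ⊛ S)) n             ≡⟨ ⊛-assoc G (tail D) S n ⟨
    ((G ⊛ tail D) ⊛ S) n             ≡⟨ ⊛-congˡ S genλ-⊛-tail-Dλ n ⟩
    (𝟙 ⊛ S) n                        ≡⟨ ⊛-identityˡ S n ⟩
    S n                              ∎
    where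
    open ≡-Reasoning
    G = genλ lam
    D = Dλ lam
    S = halfIntegerSum m
    D⊛S-at-0 : (D ⊛ S) 0 ≡ 0ℚ
    D⊛S-at-0 = trans (⊛-at-0 D S) (*-zeroˡ (S 0))

  bpoly-difference : ∀ m n → bpoly (suc n) lam (ι m) - bnum (suc n) lam ≡ ι (suc n !) * halfIntegerSum m n
  bpoly-difference m n = begin
    F * (G ⊛ e (ι m)) (suc n) - F * (G ⊛ e 0ℚ) (suc n)    ≡⟨ factor F ((G ⊛ e (ι m)) (suc n)) ((G ⊛ e 0ℚ) (suc n)) ⟩
    F * ((G ⊛ e (ι m)) (suc n) - (G ⊛ e 0ℚ) (suc n))      ≡⟨ cong (F *_) (⊛-distribˡ-⊖ G (e (ι m)) (e 0ℚ) (suc n)) ⟨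
    F * (G ⊛ (e (ι m) ⊖ e 0ℚ)) (suc n)                    ≡⟨ cong (F *_) (genλ-⊛-eλ-difference m n) ⟩
    F * halfIntegerSum m n                                ∎
    where
    open ≡-Reasoning
    F = ι (suc n !)
    G = genλ lam
    factor : ∀ f a b → f * a - f * b ≡ f * (a - b)
    factor = solve-∀ ℚ-ring

theorem2p9 : (lam : ℚ) → lam ≢ 0ℚ → (n m : ℕ) →
    (+ (2 ^ n) / suc n) * (bpoly (suc n) lam (ι m) - bnum (suc n) lam)
      ≡ Σ< m (λ l → fall (ι (2 Data.Nat.* l Data.Nat.+ 1)) n (ι 2 * lam))
theorem2p9 lam _ n m = begin
  q * (bpoly (suc n) lam (ι m) - bnum (suc n) lam)     ≡⟨ cong (q *_) (bpoly-difference lam m n) ⟩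
  q * (ι (suc n !) * ∑ m (λ l → F l * 1/! n))          ≡⟨ cong (λ u → q * (ι (suc n !) * u)) (∑-*ʳ m (1/! n) F) ⟩
  q * (ι (suc n !) * (∑ m F * 1/! n))                  ≡⟨ regroup q (ι (suc n !)) (∑ m F) (1/! n) ⟩
  q * ι (suc n !) * 1/! n * ∑ m F                      ≡⟨ cong (_* ∑ m F) ([a/n+1]*[n+1]!*[1/n!]≡a (2 ^ n) n) ⟩
  ι (2 ^ n) * ∑ m F                                    ≡⟨ ∑-*ˡ m (ι (2 ^ n)) F ⟨
  ∑ m (λ l → ι (2 ^ n) * F l)                          ≡⟨ ∑-cong m scale ⟩
  ∑ m (λ l → fall (ι (2 ℕ.* l ℕ.+ 1)) n (ι 2 * lam))   ≡⟨ Σ<≡∑ m (λ l → fall (ι (2 ℕ.* l ℕ.+ 1)) n (ι 2 * lam)) ⟨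
  Σ< m (λ l → fall (ι (2 ℕ.* l ℕ.+ 1)) n (ι 2 * lam))  ∎
  where
  open ≡-Reasoning
  q = + (2 ^ n) / suc n
  F : ℕ → ℚ
  F l = fall (ι l + ½) n lam
  scale : ∀ l → ι (2 ^ n) * F l ≡ fall (ι (2 ℕ.* l ℕ.+ 1)) n (ι 2 * lam)
  scale l = trans (fall-scale 2 n (ι l + ½) lam) (cong (λ x → fall x n (ι 2 * lam)) (sym (odd≡2*[l+½] l)))
  regroup : ∀ q f s r → q * (f * (s * r)) ≡ q * f * r * s
  regroup = solve-∀ ℚ-ring
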